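{- Let $C$ be the cycle $C_{15}$ with vertices labeled $a_0,\dots,a_4,b_0,\dots,b_4,c_0,\dots,c_4$ in cyclic order, and $t_i=\{a_i,b_i,c_i\}$. Define: $M_6$ is obtained from $C$ by attaching a copy of $H_3$ to each of $t_0,\dots,t_4$; $M_5$ is obtained from $C$ plus the chord $a_0b_0$ by attaching a copy of $H_3$ to each of $t_1,\dots,t_4$; $M_4$ is obtained from $C$ plus the chords $a_0b_0$ and $a_4b_4$ by attaching a copy of $H_3$ to each of $t_1,t_2,t_3$. (Attaching a copy of $H_3$ to a triple means identifying its three free nodes one-to-one with the three vertices of the triple.) Then the maximum genera of $M_4$, $M_5$, $M_6$ are $7$, $9$, and $10$, respectively.
   Context: $H_3$ is the graph obtained from $K_{2,3}$ by attaching a pendant vertex to each of its three vertices of degree 2; these pendant vertices are the free nodes. The maximum genus of a graph is the largest $k$ such that it has a cellular embedding in the closed orientable surface of genus $k$. (Up to smoothing degree-2 vertices, $M_4$ is Milgram's 28-vertex cubic graph.) -}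

module Defs where

open import Data.Nat using (ℕ; zero; suc; _+_; _*_; _≤_; _≤?_; _%_)
open import Data.Nat.Properties using ()
open import Data.Fin using (Fin; toℕ; splitAt; join)
open import Data.Fin.Properties using (all?)
open import Data.Fin.Permutation using (Permutation′; _⟨$⟩ʳ_)
open import Data.List using (List; []; _∷_; _++_; length; lookup; map; concatMap; filter; upTo)
open import Data.Product using (Σ; ∃-syntax; _×_; _,_; proj₁; proj₂)
open import Data.Sum using (inj₁; inj₂; swap)
open import Relation.Binary.PropositionalEquality using (_≡_)

-- Finite graphs: vertices 0 … V-1, edges given as a list of unordered
-- pairs of vertex labels (each listed once).

record Graph : Set where
  constructor mkGraph
  field
    V     : ℕ
    edges : List (ℕ × ℕ)

module _ (G : Graph) where
  open Graph G

  E : ℕ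
  E = length edges

  -- darts (half-edges): the first copy of Fin E is the edge oriented as
  -- listed, the second copy is the reversed orientation.
  Dart : Set
  Dart = Fin (E + E)

  tail : Dart → ℕ
  tail d with splitAt E d
  ... | inj₁ e = proj₁ (lookup edges e)
  ... | inj₂ e = proj₂ (lookup edges e)

  rev : Dart → Dart
  rev d = join E E (swap (splitAt E d))

iter : {A : Set} → (A → A) → ℕ → A → A
iter f zero    x = x
iter f (suc k) x = f (iter f k x)

record RotationSystem (G : Graph) : Set where
  field
    ρ          : Permutation′ (E G + E G)
    preserves  : ∀ d → tail G (ρ ⟨$⟩ʳ d) ≡ tail G d
    cyclic     : ∀ d d′ → tail G d ≡ tail G d′ → ∃[ k ] iter (ρ ⟨$⟩ʳ_) k d ≡ d′

-- Number of orbits of a permutation f of Fin N: count the darts that are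
-- the minimum of their orbit (orbits have length ≤ N).
numOrbits : (N : ℕ) → (Fin N → Fin N) → ℕ
numOrbits N f = length (filter (λ d → all? (λ (k : Fin N) → toℕ d ≤? toℕ (iter f (toℕ k) d))) (Data.List.allFin N))
  where import Data.List

-- Faces of the embedding = orbits of the face-tracing permutation ρ ∘ rev.
faces : (G : Graph) → RotationSystem G → ℕ
faces G R = numOrbits (E G + E G) (λ d → RotationSystem.ρ R ⟨$⟩ʳ rev G d)

-- G has a cellular orientable embedding of genus g (Euler: V - E + F = 2 - 2g),
-- for connected G.
HasEmbeddingOfGenus : Graph → ℕ → Set
HasEmbeddingOfGenus G g =
  Σ (RotationSystem G) λ R → Graph.V G + faces G R + 2 * g ≡ E G + 2

IsMaxGenus : Graph → ℕ → Set
IsMaxGenus G k = HasEmbeddingOfGenus G k × (∀ g → HasEmbeddingOfGenus G g → g ≤ k)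

a b c : ℕ → ℕ
a i = i
b i = 5 + i
c i = 10 + i

cycleEdges : List (ℕ × ℕ)
cycleEdges = map (λ j → j , suc j % 15) (upTo 15)

-- A copy of H₃ with new vertices base … base+4:
-- u = base, v = base+1 (degree-3 side of K_{2,3}),
-- x = base+2, y = base+3, z = base+4 (degree-2 side of K_{2,3}),
-- whose pendant (free) nodes are identified with a i, b i, c i.
H₃copy : (base i : ℕ) → List (ℕ × ℕ)
H₃copy base i =
  let u = base ; v = base + 1 ; x = base + 2 ; y = base + 3 ; z = base + 4 in
  (u , x) ∷ (u , y) ∷ (u , z) ∷ (v , x) ∷ (v , y) ∷ (v , z) ∷
  (x , a i) ∷ (y , b i) ∷ (z , c i) ∷ []

attach : ℕ → List ℕ → List (ℕ × ℕ)
attach base []       = []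
attach base (i ∷ is) = H₃copy base i ++ attach (base + 5) is

M₆ : Graph
M₆ = mkGraph 40 (cycleEdges ++ attach 15 (0 ∷ 1 ∷ 2 ∷ 3 ∷ 4 ∷ []))

M₅ : Graph
M₅ = mkGraph 35 (cycleEdges ++ (a 0 , b 0) ∷ attach 15 (1 ∷ 2 ∷ 3 ∷ 4 ∷ []))

M₄ : Graph
M₄ = mkGraph 30 (cycleEdges ++ (a 0 , b 0) ∷ (a 4 , b 4) ∷ attach 15 (1 ∷ 2 ∷ 3 ∷ []))

{-# OPTIONS --safe #-}
module Submission where

-- Euler's formula V − E + F = 2 − 2g together with F ≥ 1 bounds the genus of any
-- cellular embedding by ⌊β/2⌋, where β = E − V + 1 is the cycle rank; for M₄, M₅, M₆
-- this is 7, 9, 10.  The bound is attained by explicit rotation systems (found by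
-- computer search) with 2, 1 and 2 faces, whose validity and face counts are
-- checked by evaluation.

open import Defs
open import Data.Bool using (if_then_else_)
open import Data.Fin using (Fin; zero; suc; #_; toℕ) renaming (_≟_ to _≟ᶠ_)
open import Data.Fin.Permutation using (_⟨$⟩ʳ_; permutation)
open import Data.Fin.Properties using (all?)
open import Data.List using (tabulate)
open import Data.List.Properties using (filter-accept)
open import Data.Nat using (ℕ; zero; suc; _+_; _*_; _≤_; _≤?_; z≤n; s≤s; s≤s⁻¹)
  renaming (_≟_ to _≟ⁿ_)
open import Data.Nat.Properties
  using (≤-trans; m≤m+n; n≤1+n; ≤-refl; +-assoc; +-comm; *-suc; +-monoˡ-≤; +-monoʳ-≤;
         +-cancelˡ-≤; *-cancelˡ-<; module ≤-Reasoning)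
open import Data.Product using (_×_; _,_)
open import Data.Vec using (Vec; []; _∷_; lookup)
open import Relation.Nullary using (Dec; does)
open import Relation.Nullary.Decidable using (True; toWitness; _→-dec_)
open import Relation.Binary.PropositionalEquality using (_≡_; refl; sym; trans; cong)

numOrbits-pos : ∀ {N} (f : Fin N → Fin N) → 1 ≤ N → 1 ≤ numOrbits N f
numOrbits-pos {suc n} f _
  rewrite filter-accept (λ d → all? (λ (k : Fin (suc n)) → toℕ d ≤? toℕ (iter f (toℕ k) d)))
                        {zero} {tabulate suc} (λ _ → z≤n)
  = s≤s z≤n

faces-pos : (G : Graph) (R : RotationSystem G) → 1 ≤ E G → 1 ≤ faces G R
faces-pos G R 1≤E = numOrbits-pos _ (≤-trans 1≤E (m≤m+n (E G) (E G)))

genus≤ : ∀ V {E F g k} → V + F + 2 * g ≡ E + 2 → 1 ≤ F → E ≤ V + 2 * k → g ≤ k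
genus≤ V {E} {F} {g} {k} euler 1≤F E≤ =
  s≤s⁻¹ (*-cancelˡ-< 2 g (suc k) (+-cancelˡ-≤ V (suc (2 * g)) (2 * suc k) chain))
  where
  open ≤-Reasoning
  chain : V + suc (2 * g) ≤ V + 2 * suc k
  chain = begin
    V + suc (2 * g)   ≡⟨ sym (+-assoc V 1 (2 * g)) ⟩
    V + 1 + 2 * g     ≤⟨ +-monoˡ-≤ (2 * g) (+-monoʳ-≤ V 1≤F) ⟩
    V + F + 2 * g     ≡⟨ euler ⟩
    E + 2             ≤⟨ +-monoˡ-≤ 2 E≤ ⟩
    V + 2 * k + 2     ≡⟨ +-assoc V (2 * k) 2 ⟩
    V + (2 * k + 2)   ≡⟨ cong (V +_) (sym (trans (*-suc 2 k) (+-comm 2 (2 * k)))) ⟩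
    V + 2 * suc k     ∎

isMaxGenus : ∀ {G k} → HasEmbeddingOfGenus G k → 1 ≤ E G → E G ≤ Graph.V G + 2 * k →
             IsMaxGenus G k
isMaxGenus {G} emb 1≤E E≤ =
  emb , λ g (R , euler) → genus≤ (Graph.V G) euler (faces-pos G R 1≤E) E≤

-- Some k < n with fᵏ d ≡ d′ if there is one, and 0 otherwise.
exponentBelow : ∀ {N} → ℕ → (Fin N → Fin N) → Fin N → Fin N → ℕ
exponentBelow zero    f d d′ = 0
exponentBelow (suc n) f d d′ =
  if does (iter f n d ≟ᶠ d′) then n else exponentBelow n f d d′

module FromTable (G : Graph) (maxDegree : ℕ) (f f⁻¹ : Dart G → Dart G) where

  inverseˡ? : Dec (∀ d → f (f⁻¹ d) ≡ d)
  inverseˡ? = all? (λ d → f (f⁻¹ d) ≟ᶠ d)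

  inverseʳ? : Dec (∀ d → f⁻¹ (f d) ≡ d)
  inverseʳ? = all? (λ d → f⁻¹ (f d) ≟ᶠ d)

  preserves? : Dec (∀ d → tail G (f d) ≡ tail G d)
  preserves? = all? (λ d → tail G (f d) ≟ⁿ tail G d)

  cyclic? : Dec (∀ d d′ → tail G d ≡ tail G d′ → iter f (exponentBelow maxDegree f d d′) d ≡ d′)
  cyclic? = all? (λ d → all? (λ d′ →
    (tail G d ≟ⁿ tail G d′) →-dec (iter f (exponentBelow maxDegree f d d′) d ≟ᶠ d′)))

  rotationSystem : True inverseˡ? → True inverseʳ? → True preserves? → True cyclic? →
                   RotationSystem G
  rotationSystem inv₁ inv₂ pres cyc = record
    { ρ         = permutation f f⁻¹ (toWitness inv₁) (toWitness inv₂)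
    ; preserves = toWitness pres
    ; cyclic    = λ d d′ same → exponentBelow maxDegree f d d′ , toWitness cyc d d′ same
    }

ρ₄ : Vec (Fin 88) 88
ρ₄ = # 15 ∷ # 44 ∷ # 76 ∷ # 46 ∷ # 47 ∷ # 59 ∷ # 68 ∷ # 77 ∷ # 51 ∷ # 52 ∷ # 53 ∷ # 69 ∷ # 78 ∷ # 87 ∷ # 57 ∷ # 58 ∷ # 4 ∷ # 19 ∷ # 17 ∷ # 18 ∷ # 22 ∷ # 20 ∷ # 21 ∷ # 61 ∷ # 62 ∷ # 66 ∷ # 27 ∷ # 28 ∷ # 26 ∷ # 30 ∷ # 31 ∷ # 29 ∷ # 70 ∷ # 71 ∷ # 75 ∷ # 36 ∷ # 37 ∷ # 35 ∷ # 40 ∷ # 38 ∷ # 39 ∷ # 79 ∷ # 80 ∷ # 84 ∷ # 67 ∷ # 2 ∷ # 85 ∷ # 16 ∷ # 5 ∷ # 6 ∷ # 7 ∷ # 86 ∷ # 60 ∷ # 10 ∷ # 11 ∷ # 12 ∷ # 13 ∷ # 14 ∷ # 0 ∷ # 48 ∷ # 9 ∷ # 64 ∷ # 65 ∷ # 25 ∷ # 23 ∷ # 24 ∷ # 63 ∷ # 1 ∷ # 49 ∷ # 54 ∷ # 73 ∷ # 74 ∷ # 34 ∷ # 32 ∷ # 33 ∷ # 72 ∷ # 45 ∷ # 50 ∷ # 55 ∷ # 82 ∷ # 83 ∷ # 43 ∷ # 41 ∷ # 42 ∷ # 81 ∷ # 3 ∷ # 8 ∷ # 56 ∷ []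

ρ₄⁻¹ : Vec (Fin 88) 88
ρ₄⁻¹ = # 58 ∷ # 67 ∷ # 45 ∷ # 85 ∷ # 16 ∷ # 48 ∷ # 49 ∷ # 50 ∷ # 86 ∷ # 60 ∷ # 53 ∷ # 54 ∷ # 55 ∷ # 56 ∷ # 57 ∷ # 0 ∷ # 47 ∷ # 18 ∷ # 19 ∷ # 17 ∷ # 21 ∷ # 22 ∷ # 20 ∷ # 64 ∷ # 65 ∷ # 63 ∷ # 28 ∷ # 26 ∷ # 27 ∷ # 31 ∷ # 29 ∷ # 30 ∷ # 73 ∷ # 74 ∷ # 72 ∷ # 37 ∷ # 35 ∷ # 36 ∷ # 39 ∷ # 40 ∷ # 38 ∷ # 82 ∷ # 83 ∷ # 81 ∷ # 1 ∷ # 76 ∷ # 3 ∷ # 4 ∷ # 59 ∷ # 68 ∷ # 77 ∷ # 8 ∷ # 9 ∷ # 10 ∷ # 69 ∷ # 78 ∷ # 87 ∷ # 14 ∷ # 15 ∷ # 5 ∷ # 52 ∷ # 23 ∷ # 24 ∷ # 66 ∷ # 61 ∷ # 62 ∷ # 25 ∷ # 44 ∷ # 6 ∷ # 11 ∷ # 32 ∷ # 33 ∷ # 75 ∷ # 70 ∷ # 71 ∷ # 34 ∷ # 2 ∷ # 7 ∷ # 12 ∷ # 41 ∷ # 42 ∷ # 84 ∷ # 79 ∷ # 80 ∷ # 43 ∷ # 46 ∷ # 51 ∷ # 13 ∷ []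

ρ₅ : Vec (Fin 104) 104
ρ₅ = # 15 ∷ # 52 ∷ # 53 ∷ # 92 ∷ # 55 ∷ # 67 ∷ # 57 ∷ # 84 ∷ # 59 ∷ # 60 ∷ # 61 ∷ # 76 ∷ # 63 ∷ # 64 ∷ # 65 ∷ # 66 ∷ # 18 ∷ # 16 ∷ # 17 ∷ # 20 ∷ # 21 ∷ # 19 ∷ # 71 ∷ # 72 ∷ # 73 ∷ # 27 ∷ # 25 ∷ # 26 ∷ # 30 ∷ # 28 ∷ # 29 ∷ # 80 ∷ # 78 ∷ # 79 ∷ # 36 ∷ # 34 ∷ # 35 ∷ # 39 ∷ # 37 ∷ # 38 ∷ # 89 ∷ # 90 ∷ # 88 ∷ # 45 ∷ # 43 ∷ # 44 ∷ # 48 ∷ # 46 ∷ # 47 ∷ # 98 ∷ # 96 ∷ # 100 ∷ # 74 ∷ # 83 ∷ # 3 ∷ # 101 ∷ # 5 ∷ # 75 ∷ # 7 ∷ # 93 ∷ # 102 ∷ # 10 ∷ # 11 ∷ # 85 ∷ # 94 ∷ # 103 ∷ # 0 ∷ # 56 ∷ # 22 ∷ # 23 ∷ # 24 ∷ # 68 ∷ # 69 ∷ # 70 ∷ # 1 ∷ # 6 ∷ # 62 ∷ # 31 ∷ # 81 ∷ # 82 ∷ # 77 ∷ # 32 ∷ # 33 ∷ # 2 ∷ # 58 ∷ # 12 ∷ # 40 ∷ # 41 ∷ # 91 ∷ # 86 ∷ # 87 ∷ # 42 ∷ # 54 ∷ # 8 ∷ # 13 ∷ # 49 ∷ # 99 ∷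 # 51 ∷ # 95 ∷ # 50 ∷ # 97 ∷ # 4 ∷ # 9 ∷ # 14 ∷ []

ρ₅⁻¹ : Vec (Fin 104) 104
ρ₅⁻¹ = # 66 ∷ # 74 ∷ # 83 ∷ # 54 ∷ # 101 ∷ # 56 ∷ # 75 ∷ # 58 ∷ # 93 ∷ # 102 ∷ # 61 ∷ # 62 ∷ # 85 ∷ # 94 ∷ # 103 ∷ # 0 ∷ # 17 ∷ # 18 ∷ # 16 ∷ # 21 ∷ # 19 ∷ # 20 ∷ # 68 ∷ # 69 ∷ # 70 ∷ # 26 ∷ # 27 ∷ # 25 ∷ # 29 ∷ # 30 ∷ # 28 ∷ # 77 ∷ # 81 ∷ # 82 ∷ # 35 ∷ # 36 ∷ # 34 ∷ # 38 ∷ # 39 ∷ # 37 ∷ # 86 ∷ # 87 ∷ # 91 ∷ # 44 ∷ # 45 ∷ # 43 ∷ # 47 ∷ # 48 ∷ # 46 ∷ # 95 ∷ # 99 ∷ # 97 ∷ # 1 ∷ # 2 ∷ # 92 ∷ # 4 ∷ # 67 ∷ # 6 ∷ # 84 ∷ # 8 ∷ # 9 ∷ # 10 ∷ # 76 ∷ # 12 ∷ # 13 ∷ # 14 ∷ # 15 ∷ # 5 ∷ # 71 ∷ # 72 ∷ # 73 ∷ # 22 ∷ # 23 ∷ # 24 ∷ # 52 ∷ # 57 ∷ # 11 ∷ # 80 ∷ # 32 ∷ # 33 ∷ # 31 ∷ # 78 ∷ # 79 ∷ # 53 ∷ # 7 ∷ # 63 ∷ # 89 ∷ # 90 ∷ #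 42 ∷ # 40 ∷ # 41 ∷ # 88 ∷ # 3 ∷ # 59 ∷ # 64 ∷ # 98 ∷ # 50 ∷ # 100 ∷ # 49 ∷ # 96 ∷ # 51 ∷ # 55 ∷ # 60 ∷ # 65 ∷ []

ρ₆ : Vec (Fin 120) 120
ρ₆ = # 81 ∷ # 60 ∷ # 99 ∷ # 62 ∷ # 117 ∷ # 82 ∷ # 91 ∷ # 100 ∷ # 67 ∷ # 68 ∷ # 83 ∷ # 70 ∷ # 101 ∷ # 110 ∷ # 73 ∷ # 17 ∷ # 15 ∷ # 16 ∷ # 20 ∷ # 18 ∷ # 19 ∷ # 75 ∷ # 76 ∷ # 80 ∷ # 25 ∷ # 26 ∷ # 24 ∷ # 28 ∷ # 29 ∷ # 27 ∷ # 84 ∷ # 85 ∷ # 89 ∷ # 34 ∷ # 35 ∷ # 33 ∷ # 38 ∷ # 36 ∷ # 37 ∷ # 93 ∷ # 94 ∷ # 98 ∷ # 43 ∷ # 44 ∷ # 42 ∷ # 46 ∷ # 47 ∷ # 45 ∷ # 105 ∷ # 103 ∷ # 104 ∷ # 53 ∷ # 51 ∷ # 52 ∷ # 56 ∷ # 54 ∷ # 55 ∷ # 111 ∷ # 115 ∷ # 113 ∷ # 90 ∷ # 2 ∷ # 108 ∷ # 4 ∷ # 5 ∷ # 6 ∷ # 7 ∷ # 109 ∷ # 118 ∷ # 10 ∷ # 92 ∷ # 12 ∷ # 13 ∷ # 119 ∷ # 0 ∷ # 78 ∷ # 79 ∷ # 23 ∷ # 21 ∷ # 22 ∷ # 77 ∷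 # 74 ∷ # 64 ∷ # 69 ∷ # 87 ∷ # 88 ∷ # 32 ∷ # 30 ∷ # 31 ∷ # 86 ∷ # 1 ∷ # 65 ∷ # 11 ∷ # 96 ∷ # 97 ∷ # 41 ∷ # 39 ∷ # 40 ∷ # 95 ∷ # 61 ∷ # 66 ∷ # 71 ∷ # 48 ∷ # 106 ∷ # 107 ∷ # 102 ∷ # 49 ∷ # 50 ∷ # 3 ∷ # 8 ∷ # 72 ∷ # 114 ∷ # 58 ∷ # 116 ∷ # 57 ∷ # 112 ∷ # 59 ∷ # 63 ∷ # 9 ∷ # 14 ∷ []

ρ₆⁻¹ : Vec (Fin 120) 120
ρ₆⁻¹ = # 74 ∷ # 90 ∷ # 61 ∷ # 108 ∷ # 63 ∷ # 64 ∷ # 65 ∷ # 66 ∷ # 109 ∷ # 118 ∷ # 69 ∷ # 92 ∷ # 71 ∷ # 72 ∷ # 119 ∷ # 16 ∷ # 17 ∷ # 15 ∷ # 19 ∷ # 20 ∷ # 18 ∷ # 78 ∷ # 79 ∷ # 77 ∷ # 26 ∷ # 24 ∷ # 25 ∷ # 29 ∷ # 27 ∷ # 28 ∷ # 87 ∷ # 88 ∷ # 86 ∷ # 35 ∷ # 33 ∷ # 34 ∷ # 37 ∷ # 38 ∷ # 36 ∷ # 96 ∷ # 97 ∷ # 95 ∷ # 44 ∷ # 42 ∷ # 43 ∷ # 47 ∷ # 45 ∷ # 46 ∷ # 102 ∷ # 106 ∷ # 107 ∷ # 52 ∷ # 53 ∷ # 51 ∷ # 55 ∷ # 56 ∷ #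 54 ∷ # 114 ∷ # 112 ∷ # 116 ∷ # 1 ∷ # 99 ∷ # 3 ∷ # 117 ∷ # 82 ∷ # 91 ∷ # 100 ∷ # 8 ∷ # 9 ∷ # 83 ∷ # 11 ∷ # 101 ∷ # 110 ∷ # 14 ∷ # 81 ∷ # 21 ∷ # 22 ∷ # 80 ∷ # 75 ∷ # 76 ∷ # 23 ∷ # 0 ∷ # 5 ∷ # 10 ∷ # 30 ∷ # 31 ∷ # 89 ∷ # 84 ∷ # 85 ∷ # 32 ∷ # 60 ∷ # 6 ∷ # 70 ∷ # 39 ∷ # 40 ∷ # 98 ∷ # 93 ∷ # 94 ∷ # 41 ∷ # 2 ∷ # 7 ∷ # 12 ∷ # 105 ∷ # 49 ∷ # 50 ∷ # 48 ∷ # 103 ∷ # 104 ∷ # 62 ∷ # 67 ∷ # 13 ∷ # 57 ∷ # 115 ∷ # 59 ∷ # 111 ∷ # 58 ∷ # 113 ∷ # 4 ∷ # 68 ∷ # 73 ∷ []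

R₄ : RotationSystem M₄
R₄ = FromTable.rotationSystem M₄ 3 (lookup ρ₄) (lookup ρ₄⁻¹) _ _ _ _

R₅ : RotationSystem M₅
R₅ = FromTable.rotationSystem M₅ 3 (lookup ρ₅) (lookup ρ₅⁻¹) _ _ _ _

R₆ : RotationSystem M₆
R₆ = FromTable.rotationSystem M₆ 3 (lookup ρ₆) (lookup ρ₆⁻¹) _ _ _ _

mainTheorem8 : IsMaxGenus M₄ 7 × IsMaxGenus M₅ 9 × IsMaxGenus M₆ 10
mainTheorem8 =
  isMaxGenus (R₄ , refl) (s≤s z≤n) ≤-refl ,
  isMaxGenus (R₅ , refl) (s≤s z≤n) (n≤1+n 52) ,
  isMaxGenus (R₆ , refl) (s≤s z≤n) ≤-refl
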